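{- Let $P$ be a zero-one matrix such that no column of $P$ contains more than one 1-entry. Then there is an $\varepsilon=\varepsilon(P)>0$ such that every $P$-free $n\times n$ zero-one matrix $A$ with at least $(1-\varepsilon)n^2$ 0-entries has an $\varepsilon n\times\varepsilon n$ all-0 submatrix.
   Context: A $k\times \ell$ matrix $P$ is contained in $A$ if there are rows $i_1<\dots<i_k$ and columns $j_1<\dots<j_\ell$ of $A$ with $A(i_a,j_b)=P(a,b)$ for all $a,b$; $A$ is $P$-free if it does not contain $P$. Floors and ceilings are omitted. -}

module Defs where

open import Data.Bool using (Bool; true; false; if_then_else_)
open import Data.Nat using (ℕ; zero; suc; _+_; _*_)
open import Data.Fin using (Fin; zero; suc; _<_)
open import Data.Fin.Subset using (Subset; _∈_; ∣_∣)
open import Data.Product using (Σ; _×_; ∃₂)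
open import Relation.Binary.PropositionalEquality using (_≡_)
open import Relation.Nullary using (¬_)
open import Data.Integer using (+_)
open import Data.Rational using (ℚ; _/_)

-- A k × l zero-one matrix (entries: true = 1, false = 0).
Matrix : ℕ → ℕ → Set
Matrix k l = Fin k → Fin l → Bool

StrictlyIncreasing : ∀ {k n} → (Fin k → Fin n) → Set
StrictlyIncreasing f = ∀ a b → a < b → f a < f b

Contains : ∀ {m n k l} → Matrix m n → Matrix k l → Set
Contains {m} {n} {k} {l} A P =
  Σ (Fin k → Fin m) λ r → Σ (Fin l → Fin n) λ c →
    StrictlyIncreasing r × StrictlyIncreasing c × (∀ a b → A (r a) (c b) ≡ P a b)

Free : ∀ {m n k l} → Matrix m n → Matrix k l → Set
Free A P = ¬ Contains A P

AtMostOneOnePerColumn : ∀ {k l} → Matrix k l → Set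
AtMostOneOnePerColumn P = ∀ j i i' → P i j ≡ true → P i' j ≡ true → i ≡ i'

sumFin : (n : ℕ) → (Fin n → ℕ) → ℕ
sumFin zero f = 0
sumFin (suc n) f = f zero + sumFin n (λ i → f (suc i))

zeros : ∀ {m n} → Matrix m n → ℕ
zeros {m} {n} A = sumFin m λ i → sumFin n λ j → if A i j then 0 else 1

toℚ : ℕ → ℚ
toℚ n = + n / 1

AllZeroOn : ∀ {m n} → Matrix m n → Subset m → Subset n → Set
AllZeroOn A R C = ∀ i j → i ∈ R → j ∈ C → A i j ≡ false

module Submission where

open import Defs

-- Cut the indices 0, …, n-1 into consecutive blocks of length L ≈ n/q, where q = 3 + 2(k + l), and call
-- a line light if it has at most d ≈ L/q ones; as A has at most n²/q⁶ ones, few lines are heavy. The rows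
-- of P are embedded one at a time, row a into row block a and column b into column block b, always on
-- light lines. To place row a, look at each column b of P with P a b = 1: its candidates are the light
-- columns of block b on which the rows placed so far have only 0s, and there are at least m ≈ d/q of them.
-- If for some such b at least m rows of block a have only 0s on these candidates, they span an m × m
-- all-0 submatrix. Otherwise some light row of block a has a 1 on a candidate of every such b and only
-- 0s on the columns placed so far; since a column of P has at most one 1, this extends the copy of P.
-- Finally the all-0 columns of P go to columns of their blocks avoiding the ones of the placed rows.
-- Hence a P-free A contains an m × m all-0 submatrix with n ≤ m (1 + q⁶), and ε = 1/(1 + q⁶) works.

module Combinatorics where

  open import Data.Bool using (Bool; T; true; false; if_then_else_; _∧_; _∨_; not)
  open import Data.Bool.Properties using (T-≡; ∧-conicalˡ; ∧-conicalʳ; ∨-conicalˡ; ∨-conicalʳ; ∨-zeroʳ; not-injective)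
  open import Data.Empty using (⊥-elim)
  open import Data.Fin as Fin using (Fin; toℕ; fromℕ<)
  open import Data.Fin.Properties using (toℕ<n; toℕ-injective; toℕ-fromℕ<; any?; ¬∀⟶∃¬)
  open import Data.Fin.Subset using (Subset; _∈_; ∣_∣; ⊤)
  open import Data.Fin.Subset.Properties using (∣⊤∣≡n)
  open import Data.Nat as ℕ using (ℕ; zero; suc; _+_; _*_; _≤_; _<_; _<ᵇ_; _≤?_; z≤n; s≤s; _/_; >-nonZero)
  open import Data.Nat.DivMod using (m/n*n≤m; m≡m%n+[m/n]*n; m%n<n)
  open import Data.Nat.Properties
  open import Algebra.Properties.CommutativeMonoid.Sum +-0-commutativeMonoid using (sum; ∑-distrib-+; ∑-comm)
  open import Algebra.Properties.Semiring.Sum +-*-semiring using (*-distribˡ-sum)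
  open import Data.Nat.Tactic.RingSolver using (solve; solve-∀)
  open import Data.List using ([]; _∷_)
  open import Data.Product using (Σ; _×_; _,_; proj₁; proj₂)
  open import Data.Sum using (_⊎_; inj₁; inj₂; [_,_]′; map₂)
  open import Data.Vec using (tabulate)
  open import Data.Vec.Properties using (lookup∘tabulate; []=⇒lookup)
  open import Function using (_∘_; Equivalence)
  open import Relation.Binary.PropositionalEquality
  open import Relation.Nullary using (yes; no)

  sumFin≡sum : ∀ n (f : Fin n → ℕ) → sumFin n f ≡ sum f
  sumFin≡sum zero    f = refl
  sumFin≡sum (suc n) f = cong (f Fin.zero +_) (sumFin≡sum n (f ∘ Fin.suc))

  sumFin-cong : ∀ n {f g : Fin n → ℕ} → (∀ i → f i ≡ g i) → sumFin n f ≡ sumFin n g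
  sumFin-cong zero    f≡g = refl
  sumFin-cong (suc n) f≡g = cong₂ _+_ (f≡g Fin.zero) (sumFin-cong n (f≡g ∘ Fin.suc))

  sumFin-mono : ∀ n {f g : Fin n → ℕ} → (∀ i → f i ≤ g i) → sumFin n f ≤ sumFin n g
  sumFin-mono zero    f≤g = z≤n
  sumFin-mono (suc n) f≤g = +-mono-≤ (f≤g Fin.zero) (sumFin-mono n (f≤g ∘ Fin.suc))

  sumFin-const : ∀ n c → sumFin n (λ _ → c) ≡ n * c
  sumFin-const zero    c = refl
  sumFin-const (suc n) c = cong (c +_) (sumFin-const n c)

  sumFin-≤-const : ∀ n {c} {f : Fin n → ℕ} → (∀ i → f i ≤ c) → sumFin n f ≤ n * c
  sumFin-≤-const n {c} f≤c = ≤-trans (sumFin-mono n f≤c) (≤-reflexive (sumFin-const n c))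

  sumFin-+ : ∀ n (f g : Fin n → ℕ) → sumFin n (λ i → f i + g i) ≡ sumFin n f + sumFin n g
  sumFin-+ n f g = begin
    sumFin n (λ i → f i + g i)  ≡⟨ sumFin≡sum n _ ⟩
    sum (λ i → f i + g i)       ≡⟨ ∑-distrib-+ f g ⟩
    sum f + sum g               ≡⟨ cong₂ _+_ (sumFin≡sum n f) (sumFin≡sum n g) ⟨
    sumFin n f + sumFin n g     ∎
    where open ≡-Reasoning

  sumFin-comm : ∀ m n (f : Fin m → Fin n → ℕ) →
    sumFin m (λ i → sumFin n (f i)) ≡ sumFin n (λ j → sumFin m (λ i → f i j))
  sumFin-comm m n f = begin
    sumFin m (λ i → sumFin n (f i))          ≡⟨ sumFin-cong m (λ i → sumFin≡sum n (f i)) ⟩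
    sumFin m (λ i → sum (f i))               ≡⟨ sumFin≡sum m _ ⟩
    sum (λ i → sum (f i))                    ≡⟨ ∑-comm f ⟩
    sum (λ j → sum (λ i → f i j))            ≡⟨ sumFin≡sum n _ ⟨
    sumFin n (λ j → sum (λ i → f i j))       ≡⟨ sumFin-cong n (λ j → sumFin≡sum m (λ i → f i j)) ⟨
    sumFin n (λ j → sumFin m (λ i → f i j))  ∎
    where open ≡-Reasoning

  sumFin-*ˡ : ∀ n c (f : Fin n → ℕ) → sumFin n (λ i → c * f i) ≡ c * sumFin n f
  sumFin-*ˡ n c f = begin
    sumFin n (λ i → c * f i)  ≡⟨ sumFin≡sum n _ ⟩
    sum (λ i → c * f i)       ≡⟨ *-distribˡ-sum c f ⟨
    c * sum f                 ≡⟨ cong (c *_) (sumFin≡sum n f) ⟨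
    c * sumFin n f            ∎
    where open ≡-Reasoning

  sumFin≡0⇒≡0 : ∀ n (f : Fin n → ℕ) → sumFin n f ≡ 0 → ∀ i → f i ≡ 0
  sumFin≡0⇒≡0 (suc n) f Σf≡0 Fin.zero    = m+n≡0⇒m≡0 (f Fin.zero) Σf≡0
  sumFin≡0⇒≡0 (suc n) f Σf≡0 (Fin.suc i) = sumFin≡0⇒≡0 n (f ∘ Fin.suc) (m+n≡0⇒n≡0 (f Fin.zero) Σf≡0) i

  sumFin-<⇒< : ∀ n (f g : Fin n → ℕ) → sumFin n f < sumFin n g → Σ (Fin n) λ i → f i < g i
  sumFin-<⇒< n f g Σf<Σg with ¬∀⟶∃¬ n (λ i → g i ≤ f i) (λ i → g i ≤? f i) (<⇒≱ Σf<Σg ∘ sumFin-mono n)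
  ... | i , gᵢ≰fᵢ = i , ≰⇒> gᵢ≰fᵢ

  𝟙 : Bool → ℕ
  𝟙 true  = 1
  𝟙 false = 0

  count : ∀ {n} → (Fin n → Bool) → ℕ
  count {n} p = sumFin n (𝟙 ∘ p)

  count-false : ∀ n → count {n} (λ _ → false) ≡ 0
  count-false n = trans (sumFin-const n 0) (*-zeroʳ n)

  𝟙-∨ : ∀ a b → 𝟙 (a ∨ b) ≤ 𝟙 a + 𝟙 b
  𝟙-∨ true  b = s≤s z≤n
  𝟙-∨ false b = ≤-refl

  count-∨ : ∀ {n} (p q : Fin n → Bool) → count (λ x → p x ∨ q x) ≤ count p + count q
  count-∨ {n} p q = ≤-trans (sumFin-mono n (λ x → 𝟙-∨ (p x) (q x))) (≤-reflexive (sumFin-+ n _ _))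

  count-∧-not : ∀ {n} (u h t : Fin n → Bool) →
    count u ≤ count (λ x → u x ∧ (not (h x) ∧ not (t x))) + (count h + count t)
  count-∧-not {n} u h t = begin
    count u                                          ≤⟨ sumFin-mono n (λ x → split (u x) (h x) (t x)) ⟩
    sumFin n (λ x → 𝟙 (v x) + (𝟙 (h x) + 𝟙 (t x)))  ≡⟨ sumFin-+ n _ _ ⟩
    count v + sumFin n (λ x → 𝟙 (h x) + 𝟙 (t x))     ≡⟨ cong (count v +_) (sumFin-+ n (𝟙 ∘ h) (𝟙 ∘ t)) ⟩
    count v + (count h + count t)                    ∎
    where
    open ≤-Reasoning
    v : Fin n → Bool
    v x = u x ∧ (not (h x) ∧ not (t x))
    split : ∀ u h t → 𝟙 u ≤ 𝟙 (u ∧ (not h ∧ not t)) + (𝟙 h + 𝟙 t)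
    split false h     t     = z≤n
    split true  false false = ≤-refl
    split true  true  t     = s≤s z≤n
    split true  false true  = s≤s z≤n

  count-<⇒witness : ∀ {n} (p q : Fin n → Bool) → count p < count q → Σ (Fin n) λ x → q x ≡ true × p x ≡ false
  count-<⇒witness {n} p q #p<#q with sumFin-<⇒< n _ _ #p<#q
  ... | x , 𝟙px<𝟙qx = x , 𝟙-< (p x) (q x) 𝟙px<𝟙qx
    where
    𝟙-< : ∀ a b → 𝟙 a < 𝟙 b → b ≡ true × a ≡ false
    𝟙-< false true  _ = refl , refl
    𝟙-< false false ()
    𝟙-< true  true  (s≤s ())
    𝟙-< true  false ()

  ∧-falseʳ : ∀ {u v} → u ≡ true → u ∧ v ≡ false → v ≡ false
  ∧-falseʳ refl v≡false = v≡false

  any : ∀ {l} → (Fin l → Bool) → Bool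
  any {zero}  f = false
  any {suc l} f = f Fin.zero ∨ any (f ∘ Fin.suc)

  any-true⇒witness : ∀ {l} (f : Fin l → Bool) → any f ≡ true → Σ (Fin l) λ b → f b ≡ true
  any-true⇒witness {suc l} f any≡true with f Fin.zero in f₀
  ... | true  = Fin.zero , f₀
  ... | false = let (b , fb) = any-true⇒witness (f ∘ Fin.suc) any≡true in Fin.suc b , fb

  any-false⇒false : ∀ {l} (f : Fin l → Bool) → any f ≡ false → ∀ b → f b ≡ false
  any-false⇒false {suc l} f any≡false Fin.zero    = ∨-conicalˡ _ _ any≡false
  any-false⇒false {suc l} f any≡false (Fin.suc b) = any-false⇒false (f ∘ Fin.suc) (∨-conicalʳ _ _ any≡false) b

  witness⇒any-true : ∀ {l} (f : Fin l → Bool) b → f b ≡ true → any f ≡ true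
  witness⇒any-true {suc l} f Fin.zero    fb rewrite fb = refl
  witness⇒any-true {suc l} f (Fin.suc b) fb rewrite witness⇒any-true (f ∘ Fin.suc) b fb = ∨-zeroʳ (f Fin.zero)

  𝟙-any : ∀ {l} (f : Fin l → Bool) → 𝟙 (any f) ≤ count f
  𝟙-any {zero}  f = z≤n
  𝟙-any {suc l} f = ≤-trans (𝟙-∨ (f Fin.zero) _) (+-monoʳ-≤ (𝟙 (f Fin.zero)) (𝟙-any (f ∘ Fin.suc)))

  count-any : ∀ {n l} (p : Fin l → Fin n → Bool) →
    count (λ x → any (λ b → p b x)) ≤ sumFin l (λ b → count (p b))
  count-any {n} {l} p = ≤-trans (sumFin-mono n (λ x → 𝟙-any (λ b → p b x)))
                                 (≤-reflexive (sumFin-comm n l (λ x b → 𝟙 (p b x))))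

  ∣tabulate∣ : ∀ n (p : Fin n → Bool) → ∣ tabulate p ∣ ≡ count p
  ∣tabulate∣ zero    p = refl
  ∣tabulate∣ (suc n) p with p Fin.zero
  ... | true  = cong suc (∣tabulate∣ n (p ∘ Fin.suc))
  ... | false = ∣tabulate∣ n (p ∘ Fin.suc)

  ∈-tabulate⇒ : ∀ {n} (p : Fin n → Bool) x → x ∈ tabulate p → p x ≡ true
  ∈-tabulate⇒ p x x∈p = trans (sym (lookup∘tabulate p x)) ([]=⇒lookup x∈p)

  <ᵇ≡true⇒< : ∀ a b → (a <ᵇ b) ≡ true → a < b
  <ᵇ≡true⇒< a b a<ᵇb = <ᵇ⇒< a b (Equivalence.from T-≡ a<ᵇb)

  <ᵇ≡false⇒≥ : ∀ a b → (a <ᵇ b) ≡ false → b ≤ a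
  <ᵇ≡false⇒≥ a b a≮ᵇb = ≮⇒≥ λ a<b → subst T a≮ᵇb (<⇒<ᵇ a<b)

  <⇒<ᵇ≡true : ∀ {a b} → a < b → (a <ᵇ b) ≡ true
  <⇒<ᵇ≡true a<b = Equivalence.to T-≡ (<⇒<ᵇ a<b)

  <ᵇ-irrefl : ∀ a → (a <ᵇ a) ≡ false
  <ᵇ-irrefl zero    = refl
  <ᵇ-irrefl (suc a) = <ᵇ-irrefl a

  count-exceeding : ∀ n d (f : Fin n → ℕ) → suc d * count (λ x → d <ᵇ f x) ≤ sumFin n f
  count-exceeding n d f = ≤-trans (≤-reflexive (sym (sumFin-*ˡ n (suc d) _))) (sumFin-mono n bound)
    where
    bound : ∀ x → suc d * 𝟙 (d <ᵇ f x) ≤ f x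
    bound x with d <ᵇ f x in d<fx
    ... | true  = ≤-trans (≤-reflexive (*-identityʳ (suc d))) (<ᵇ≡true⇒< d (f x) d<fx)
    ... | false = ≤-trans (≤-reflexive (*-zeroʳ d)) z≤n

  inInterval : ℕ → ℕ → ℕ → Bool
  inInterval (suc s) L       zero    = false
  inInterval (suc s) L       (suc x) = inInterval s L x
  inInterval zero    zero    x       = false
  inInterval zero    (suc L) zero    = true
  inInterval zero    (suc L) (suc x) = inInterval zero L x

  inInterval⇒bounds : ∀ s L x → inInterval s L x ≡ true → s ≤ x × x < s + L
  inInterval⇒bounds (suc s) L       (suc x) x∈ =
    let (s≤x , x<s+L) = inInterval⇒bounds s L x x∈ in s≤s s≤x , s≤s x<s+L
  inInterval⇒bounds zero    (suc L) zero    x∈ = z≤n , s≤s z≤n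
  inInterval⇒bounds zero    (suc L) (suc x) x∈ = z≤n , s≤s (proj₂ (inInterval⇒bounds zero L x x∈))

  count-inInterval : ∀ n s L → s + L ≤ n → count (λ (i : Fin n) → inInterval s L (toℕ i)) ≡ L
  count-inInterval zero    zero    zero    _         = refl
  count-inInterval (suc n) (suc s) L       (s≤s s+L≤n) = count-inInterval n s L s+L≤n
  count-inInterval (suc n) zero    zero    _         = count-false n
  count-inInterval (suc n) zero    (suc L) (s≤s L≤n) = cong suc (count-inInterval n zero L L≤n)

  inInterval-ordered : ∀ L a a′ u v → a < a′ →
    inInterval (a * L) L u ≡ true → inInterval (a′ * L) L v ≡ true → u < v
  inInterval-ordered L a a′ u v a<a′ u∈ v∈ = begin-strict
    u              <⟨ proj₂ (inInterval⇒bounds (a * L) L u u∈) ⟩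
    a * L + L      ≡⟨ +-comm (a * L) L ⟩
    suc a * L      ≤⟨ *-monoˡ-≤ L a<a′ ⟩
    a′ * L         ≤⟨ proj₁ (inInterval⇒bounds (a′ * L) L v v∈) ⟩
    v              ∎
    where open ≤-Reasoning

  ones : ∀ {m n} → Matrix m n → ℕ
  ones {m} A = sumFin m (λ x → count (A x))

  zeros+ones : ∀ {m n} (A : Matrix m n) → zeros A + ones A ≡ m * n
  zeros+ones {m} {n} A = begin
    zeros A + ones A                                   ≡⟨ sumFin-+ m _ _ ⟨
    sumFin m (λ x → sumFin n (zero? x) + count (A x))  ≡⟨ sumFin-cong m row ⟩
    sumFin m (λ x → n)                                 ≡⟨ sumFin-const m n ⟩
    m * n                                              ∎
    where
    open ≡-Reasoning
    zero? : Fin m → Fin n → ℕ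
    zero? x y = if A x y then 0 else 1
    entry : ∀ b → (if b then 0 else 1) + 𝟙 b ≡ 1
    entry true  = refl
    entry false = refl
    row : ∀ x → sumFin n (zero? x) + count (A x) ≡ n
    row x = begin
      sumFin n (zero? x) + count (A x)        ≡⟨ sumFin-+ n _ _ ⟨
      sumFin n (λ y → zero? x y + 𝟙 (A x y))  ≡⟨ sumFin-cong n (λ y → entry (A x y)) ⟩
      sumFin n (λ y → 1)                      ≡⟨ sumFin-const n 1 ⟩
      n * 1                                   ≡⟨ *-identityʳ n ⟩
      n                                       ∎

  ones≡0⇒allZero : ∀ {m n} (A : Matrix m n) → ones A ≡ 0 → ∀ i j → A i j ≡ false
  ones≡0⇒allZero {m} {n} A no-ones i j with A i j in Aij
  ... | false = refl
  ... | true  = ⊥-elim (1≢0 (sumFin≡0⇒≡0 n _ (sumFin≡0⇒≡0 m _ no-ones i) j))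
    where
    1≢0 : 𝟙 (A i j) ≢ 0
    1≢0 rewrite Aij = λ ()

  -- e N ≤ Z (1 + e) is (1 - 1/(1+e)) N ≤ Z cleared of denominators; Z and W count the 0s and the 1s.
  few-ones : ∀ {e N Z W} → Z + W ≡ N → e * N ≤ Z * suc e → W * e ≤ N
  few-ones {e} {N} {Z} {W} Z+W≡N eN≤Z[1+e] = begin
    W * e  ≡⟨ *-comm W e ⟩
    e * W  ≤⟨ +-cancelʳ-≤ (Z * e) (e * W) Z eW+Ze≤Z+Ze ⟩
    Z      ≤⟨ m≤m+n Z W ⟩
    Z + W  ≡⟨ Z+W≡N ⟩
    N      ∎
    where
    open ≤-Reasoning
    eW+Ze≤Z+Ze : e * W + Z * e ≤ Z + Z * e
    eW+Ze≤Z+Ze = begin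
      e * W + Z * e  ≡⟨ solve (e ∷ W ∷ Z ∷ []) ⟩
      e * (Z + W)    ≡⟨ cong (e *_) Z+W≡N ⟩
      e * N          ≤⟨ eN≤Z[1+e] ⟩
      Z * suc e      ≡⟨ *-suc Z e ⟩
      Z + Z * e      ∎

  /-bounds : ∀ x D .{{_ : ℕ.NonZero D}} → (x / D) * D ≤ x × x < suc (x / D) * D
  /-bounds x D = m/n*n≤m x D ,
    subst (_< suc (x / D) * D) (sym (m≡m%n+[m/n]*n x D)) (+-monoˡ-< ((x / D) * D) (m%n<n x D))

  module Embedding {k l n : ℕ} (P : Matrix k l) (P-col : AtMostOneOnePerColumn P) (A : Matrix n n)
                   (default : Fin n) (L d m : ℕ) where

    inBlock : ℕ → Fin n → Bool
    inBlock a x = inInterval (a * L) L (toℕ x)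

    rowOnes colOnes : Fin n → ℕ
    rowOnes x = count (A x)
    colOnes y = count (λ x → A x y)

    heavyRow heavyCol : Fin n → Bool
    heavyRow x = d <ᵇ rowOnes x
    heavyCol y = d <ᵇ colOnes y

    #heavyRows #heavyCols : ℕ
    #heavyRows = count heavyRow
    #heavyCols = count heavyCol

    ZeroRectangle : Set
    ZeroRectangle = Σ (Subset n) λ R → Σ (Subset n) λ C → m ≤ ∣ R ∣ × m ≤ ∣ C ∣ × AllZeroOn A R C

    record Embedded (a : ℕ) (r : Fin k → Fin n) (c : Fin l → Fin n) : Set where
      field
        row-inBlock : ∀ i → toℕ i < a → inBlock (toℕ i) (r i) ≡ true
        row-light   : ∀ i → toℕ i < a → heavyRow (r i) ≡ false
        col-inBlock : ∀ b i → toℕ i < a → P i b ≡ true → inBlock (toℕ b) (c b) ≡ true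
        col-light   : ∀ b i → toℕ i < a → P i b ≡ true → heavyCol (c b) ≡ false
        agrees      : ∀ b i → toℕ i < a → P i b ≡ true → ∀ i′ → toℕ i′ < a → A (r i′) (c b) ≡ P i′ b

    Stage : ℕ → Set
    Stage a = ZeroRectangle ⊎ Σ (Fin k → Fin n) λ r → Σ (Fin l → Fin n) λ c → Embedded a r c

    column-one-unique : ∀ b {i i′} → i ≢ i′ → P i b ≡ true → P i′ b ≡ false
    column-one-unique b {i} {i′} i≢i′ Pib with P i′ b in Pi′b
    ... | false = refl
    ... | true  = ⊥-elim (i≢i′ (P-col b i i′ Pib Pi′b))

    module _ (kL≤n : k * L ≤ n) (lL≤n : l * L ≤ n) (row-budget : #heavyRows + l * d + l * m < L)
             (col-budget : m + #heavyCols + k * d ≤ L) (kd<L : k * d < L) where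

      count-inBlock : ∀ {j} (a : Fin j) → j * L ≤ n → count (inBlock (toℕ a)) ≡ L
      count-inBlock a jL≤n = count-inInterval n (toℕ a * L) L
        (≤-trans (≤-reflexive (+-comm (toℕ a * L) L)) (≤-trans (*-monoˡ-≤ L (toℕ<n a)) jL≤n))

      count-hit-by-light-rows : ∀ (r : Fin k → Fin n) (chosen : Fin k → Bool) →
        (∀ i → chosen i ≡ true → heavyRow (r i) ≡ false) →
        count (λ y → any (λ i → chosen i ∧ A (r i) y)) ≤ k * d
      count-hit-by-light-rows r chosen light =
        ≤-trans (count-any (λ i y → chosen i ∧ A (r i) y)) (sumFin-≤-const k bound)
        where
        bound : ∀ i → count (λ y → chosen i ∧ A (r i) y) ≤ d
        bound i with chosen i in chosen-i
        ... | false = ≤-trans (≤-reflexive (count-false n)) z≤n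
        ... | true  = <ᵇ≡false⇒≥ d (rowOnes (r i)) (light i chosen-i)

      module Extend (a : Fin k) {r : Fin k → Fin n} {c : Fin l → Fin n} (emb : Embedded (toℕ a) r c) where
        open Embedded emb

        earlier : Fin k → Bool
        earlier i = toℕ i <ᵇ toℕ a

        hitByEarlierRow : Fin n → Bool
        hitByEarlierRow y = any (λ i → earlier i ∧ A (r i) y)

        usedCol : Fin l → Bool
        usedCol b = any (λ i → earlier i ∧ P i b)

        candidate : Fin l → Fin n → Bool
        candidate b y = inBlock (toℕ b) y ∧ (not (heavyCol y) ∧ not (hitByEarlierRow y))

        candidate⇒ : ∀ {b y} → candidate b y ≡ true →
          inBlock (toℕ b) y ≡ true × heavyCol y ≡ false × hitByEarlierRow y ≡ false
        candidate⇒ {b} {y} cand = ∧-conicalˡ _ _ cand ,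
          not-injective (∧-conicalˡ _ _ rest) , not-injective (∧-conicalʳ _ _ rest)
          where rest = ∧-conicalʳ (inBlock (toℕ b) y) _ cand

        hitsCandidate : Fin l → Fin n → Bool
        hitsCandidate b x = any (λ y → candidate b y ∧ A x y)

        blocking : Fin l → Fin n → Bool
        blocking b x = inBlock (toℕ a) x ∧ (P a b ∧ not (hitsCandidate b x))

        blocking⇒misses : ∀ {b x} → blocking b x ≡ true → hitsCandidate b x ≡ false
        blocking⇒misses {b} {x} blk = not-injective (∧-conicalʳ (P a b) _ (∧-conicalʳ (inBlock (toℕ a) x) _ blk))

        hitsUsedCol : Fin n → Bool
        hitsUsedCol x = any (λ b → usedCol b ∧ A x (c b))

        blocked : Fin n → Bool
        blocked x = any (λ b → blocking b x)

        unusable : Fin n → Bool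
        unusable x = heavyRow x ∨ (hitsUsedCol x ∨ blocked x)

        count-candidate : ∀ b → m ≤ count (candidate b)
        count-candidate b = +-cancelʳ-≤ (#heavyCols + k * d) m #cand (begin
          m + (#heavyCols + k * d)                      ≡⟨ +-assoc m #heavyCols (k * d) ⟨
          m + #heavyCols + k * d                        ≤⟨ col-budget ⟩
          L                                             ≡⟨ count-inBlock b lL≤n ⟨
          count (inBlock (toℕ b))                       ≤⟨ count-∧-not (inBlock (toℕ b)) heavyCol hitByEarlierRow ⟩
          #cand + (#heavyCols + count hitByEarlierRow)  ≤⟨ +-monoʳ-≤ #cand (+-monoʳ-≤ #heavyCols few-hit) ⟩
          #cand + (#heavyCols + k * d)                  ∎)
          where
          open ≤-Reasoning
          #cand : ℕ
          #cand = count (candidate b)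
          few-hit : count hitByEarlierRow ≤ k * d
          few-hit = count-hit-by-light-rows r earlier (λ i → row-light i ∘ <ᵇ≡true⇒< _ _)

        blocking⇒zeroRectangle : ∀ b → m ≤ count (blocking b) → ZeroRectangle
        blocking⇒zeroRectangle b m≤#blocking =
          tabulate (blocking b) , tabulate (candidate b) ,
          subst (m ≤_) (sym (∣tabulate∣ n _)) m≤#blocking ,
          subst (m ≤_) (sym (∣tabulate∣ n _)) (count-candidate b) ,
          zero-on
          where
          zero-on : AllZeroOn A (tabulate (blocking b)) (tabulate (candidate b))
          zero-on x y x∈ y∈ = ∧-falseʳ (∈-tabulate⇒ (candidate b) y y∈)
            (any-false⇒false (λ y → candidate b y ∧ A x y) (blocking⇒misses (∈-tabulate⇒ (blocking b) x x∈)) y)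

        count-hitsUsedCol : count hitsUsedCol ≤ l * d
        count-hitsUsedCol = ≤-trans (count-any (λ b x → usedCol b ∧ A x (c b))) (sumFin-≤-const l bound)
          where
          bound : ∀ b → count (λ x → usedCol b ∧ A x (c b)) ≤ d
          bound b with usedCol b in used
          ... | false = ≤-trans (≤-reflexive (count-false n)) z≤n
          ... | true  with any-true⇒witness _ used
          ...   | i , earlier∧Pib = <ᵇ≡false⇒≥ d (colOnes (c b))
                    (col-light b i (<ᵇ≡true⇒< _ _ (∧-conicalˡ _ _ earlier∧Pib)) (∧-conicalʳ _ _ earlier∧Pib))

        usable-row : (∀ b → count (blocking b) < m) →
          Σ (Fin n) λ x → inBlock (toℕ a) x ≡ true × unusable x ≡ false
        usable-row few-blocking = count-<⇒witness unusable (inBlock (toℕ a)) (begin-strict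
          count unusable                                ≤⟨ count-∨ heavyRow _ ⟩
          #heavyRows + count (λ x → hitsUsedCol x ∨ blocked x)
                                                        ≤⟨ +-monoʳ-≤ #heavyRows (count-∨ hitsUsedCol blocked) ⟩
          #heavyRows + (count hitsUsedCol + count blocked)
                                                        ≤⟨ +-monoʳ-≤ #heavyRows (+-mono-≤ count-hitsUsedCol few-blocked) ⟩
          #heavyRows + (l * d + l * m)                  ≡⟨ +-assoc #heavyRows _ _ ⟨
          #heavyRows + l * d + l * m                    <⟨ row-budget ⟩
          L                                             ≡⟨ count-inBlock a kL≤n ⟨
          count (inBlock (toℕ a))                       ∎)
          where
          open ≤-Reasoning
          few-blocked : count blocked ≤ l * m
          few-blocked = ≤-trans (count-any blocking) (sumFin-≤-const l (<⇒≤ ∘ few-blocking))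

        older-or-new : ∀ i → toℕ i < suc (toℕ a) → toℕ i < toℕ a ⊎ i ≡ a
        older-or-new i i≤a = map₂ toℕ-injective (m<1+n⇒m<n∨m≡n i≤a)

        older⇒≢ : ∀ {i} → toℕ i < toℕ a → i ≢ a
        older⇒≢ i<a refl = <-irrefl refl i<a

        earlier-row-misses : ∀ i → toℕ i < toℕ a → ∀ y → hitByEarlierRow y ≡ false → A (r i) y ≡ false
        earlier-row-misses i i<a y no-hit =
          ∧-falseʳ (<⇒<ᵇ≡true i<a) (any-false⇒false (λ i → earlier i ∧ A (r i) y) no-hit i)

        module Place (x : Fin n) (x-inBlock : inBlock (toℕ a) x ≡ true) (x-usable : unusable x ≡ false) where

          x-light : heavyRow x ≡ false
          x-light = ∨-conicalˡ _ _ x-usable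

          x-avoids : hitsUsedCol x ≡ false
          x-avoids = ∨-conicalˡ _ _ (∨-conicalʳ (heavyRow x) _ x-usable)

          x-unblocked : ∀ b → blocking b x ≡ false
          x-unblocked = any-false⇒false (λ b → blocking b x)
            (∨-conicalʳ (hitsUsedCol x) _ (∨-conicalʳ (heavyRow x) _ x-usable))

          x-avoids-used : ∀ b i → toℕ i < toℕ a → P i b ≡ true → A x (c b) ≡ false
          x-avoids-used b i i<a Pib = ∧-falseʳ
            (witness⇒any-true (λ i → earlier i ∧ P i b) i (cong₂ _∧_ (<⇒<ᵇ≡true i<a) Pib))
            (any-false⇒false (λ b → usedCol b ∧ A x (c b)) x-avoids b)

          newColumn : ∀ b → Σ (Fin n) λ y → P a b ≡ true → candidate b y ≡ true × A x y ≡ true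
          newColumn b with hitsCandidate b x in hits
          ... | true  = let (y , found) = any-true⇒witness (λ y → candidate b y ∧ A x y) hits in
                        y , λ _ → ∧-conicalˡ (candidate b y) _ found , ∧-conicalʳ (candidate b y) _ found
          ... | false = c b , λ Pab → ⊥-elim (true≢false (trans (sym (x-blocking Pab)) (x-unblocked b)))
            where
            true≢false : true ≢ false
            true≢false ()
            x-blocking : P a b ≡ true → blocking b x ≡ true
            x-blocking Pab rewrite x-inBlock | Pab | hits = refl

          c′ : Fin l → Fin n
          c′ b = if P a b then proj₁ (newColumn b) else c b

          c′-old : ∀ b i → toℕ i < toℕ a → P i b ≡ true → c′ b ≡ c b
          c′-old b i i<a Pib = cong (if_then proj₁ (newColumn b) else c b) (column-one-unique b (older⇒≢ i<a) Pib)

          c′-new : ∀ b → P a b ≡ true → candidate b (c′ b) ≡ true × A x (c′ b) ≡ true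
          c′-new b Pab = subst (λ y → candidate b y ≡ true × A x y ≡ true)
            (sym (cong (if_then proj₁ (newColumn b) else c b) Pab)) (proj₂ (newColumn b) Pab)

          r′ : Fin k → Fin n
          r′ i = if earlier i then r i else x

          r′-old : ∀ {i} → toℕ i < toℕ a → r′ i ≡ r i
          r′-old {i} i<a = cong (if_then r i else x) (<⇒<ᵇ≡true i<a)

          r′-new : r′ a ≡ x
          r′-new = cong (if_then r a else x) (<ᵇ-irrefl (toℕ a))

          extended : Embedded (suc (toℕ a)) r′ c′
          extended = record
            { row-inBlock = row-inBlock′ ; row-light = row-light′
            ; col-inBlock = col-inBlock′ ; col-light = col-light′ ; agrees = agrees′ }
            where
            row-inBlock′ : ∀ i → toℕ i < suc (toℕ a) → inBlock (toℕ i) (r′ i) ≡ true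
            row-inBlock′ i i≤a with older-or-new i i≤a
            ... | inj₁ i<a rewrite r′-old i<a = row-inBlock i i<a
            ... | inj₂ refl rewrite r′-new = x-inBlock

            row-light′ : ∀ i → toℕ i < suc (toℕ a) → heavyRow (r′ i) ≡ false
            row-light′ i i≤a with older-or-new i i≤a
            ... | inj₁ i<a rewrite r′-old i<a = row-light i i<a
            ... | inj₂ refl rewrite r′-new = x-light

            col-inBlock′ : ∀ b i → toℕ i < suc (toℕ a) → P i b ≡ true → inBlock (toℕ b) (c′ b) ≡ true
            col-inBlock′ b i i≤a Pib with older-or-new i i≤a
            ... | inj₁ i<a rewrite c′-old b i i<a Pib = col-inBlock b i i<a Pib
            ... | inj₂ refl = proj₁ (candidate⇒ {b} (proj₁ (c′-new b Pib)))

            col-light′ : ∀ b i → toℕ i < suc (toℕ a) → P i b ≡ true → heavyCol (c′ b) ≡ false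
            col-light′ b i i≤a Pib with older-or-new i i≤a
            ... | inj₁ i<a rewrite c′-old b i i<a Pib = col-light b i i<a Pib
            ... | inj₂ refl = proj₁ (proj₂ (candidate⇒ {b} (proj₁ (c′-new b Pib))))

            -- A new column meets the earlier rows only in 0s, and P has 0s there because column b of P
            -- has its single 1 in row a; symmetrically for the new row and the old columns.
            agrees′ : ∀ b i → toℕ i < suc (toℕ a) → P i b ≡ true →
                      ∀ i′ → toℕ i′ < suc (toℕ a) → A (r′ i′) (c′ b) ≡ P i′ b
            agrees′ b i i≤a Pib i′ i′≤a with older-or-new i i≤a | older-or-new i′ i′≤a
            ... | inj₁ i<a | inj₁ i′<a rewrite c′-old b i i<a Pib | r′-old i′<a = agrees b i i<a Pib i′ i′<a
            ... | inj₁ i<a | inj₂ refl rewrite c′-old b i i<a Pib | r′-new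
                                       | column-one-unique b (older⇒≢ i<a) Pib = x-avoids-used b i i<a Pib
            ... | inj₂ refl | inj₁ i′<a rewrite r′-old i′<a =
                  trans (earlier-row-misses i′ i′<a (c′ b) (proj₂ (proj₂ (candidate⇒ {b} (proj₁ (c′-new b Pib))))))
                        (sym (column-one-unique b (older⇒≢ i′<a ∘ sym) Pib))
            ... | inj₂ refl | inj₂ refl rewrite r′-new = trans (proj₂ (c′-new b Pib)) (sym Pib)

        extend : Stage (suc (toℕ a))
        extend with any? (λ b → m ≤? count (blocking b))
        ... | yes (b , m≤#blocking) = inj₁ (blocking⇒zeroRectangle b m≤#blocking)
        ... | no no-blocking with usable-row (λ b → ≰⇒> (no-blocking ∘ (b ,_)))
        ...   | x , x-inBlock , x-usable = inj₂ (r′ , c′ , extended)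
          where open Place x x-inBlock x-usable

      embed-rows : ∀ a → a ≤ k → Stage a
      embed-rows zero    _   = inj₂ ((λ _ → default) , (λ _ → default) , record
        { row-inBlock = λ _ () ; row-light = λ _ () ; col-inBlock = λ _ _ () ; col-light = λ _ _ () ; agrees = λ _ _ () })
      embed-rows (suc a) a<k with embed-rows a (<⇒≤ a<k)
      ... | inj₁ rectangle       = inj₁ rectangle
      ... | inj₂ (r , c , emb) = subst (Stage ∘ suc) (toℕ-fromℕ< a<k)
        (Extend.extend (fromℕ< a<k) (subst (λ j → Embedded j r c) (sym (toℕ-fromℕ< a<k)) emb))

      module Complete {r : Fin k → Fin n} {c : Fin l → Fin n} (emb : Embedded k r c) where
        open Embedded emb

        hitByRow : Fin n → Bool
        hitByRow y = any (λ i → A (r i) y)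

        freshColumn : ∀ (b : Fin l) → Σ (Fin n) λ y → inBlock (toℕ b) y ≡ true × hitByRow y ≡ false
        freshColumn b = count-<⇒witness hitByRow (inBlock (toℕ b)) (begin-strict
          count hitByRow           ≤⟨ count-hit-by-light-rows r (λ _ → true) (λ i _ → row-light i (toℕ<n i)) ⟩
          k * d                    <⟨ kd<L ⟩
          L                        ≡⟨ count-inBlock b lL≤n ⟨
          count (inBlock (toℕ b))  ∎)
          where open ≤-Reasoning

        nonzeroCol : Fin l → Bool
        nonzeroCol b = any (λ i → P i b)

        c′ : Fin l → Fin n
        c′ b = if nonzeroCol b then c b else proj₁ (freshColumn b)

        c′-inBlock : ∀ b → inBlock (toℕ b) (c′ b) ≡ true
        c′-inBlock b with nonzeroCol b in nz
        ... | true  = let (i , Pib) = any-true⇒witness (λ i → P i b) nz in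
                  col-inBlock b i (toℕ<n i) Pib
        ... | false = proj₁ (proj₂ (freshColumn b))

        c′-agrees : ∀ i b → A (r i) (c′ b) ≡ P i b
        c′-agrees i b with nonzeroCol b in nz
        ... | true  = let (i′ , Pi′b) = any-true⇒witness (λ i → P i b) nz in
                  agrees b i′ (toℕ<n i′) Pi′b i (toℕ<n i)
        ... | false =
              trans (any-false⇒false (λ i → A (r i) _) (proj₂ (proj₂ (freshColumn b))) i)
                    (sym (any-false⇒false (λ i → P i b) nz i))

        contains : Contains A P
        contains = r , c′ , r-increasing , c′-increasing , c′-agrees
          where
          r-increasing : StrictlyIncreasing r
          r-increasing i i′ i<i′ =
            inInterval-ordered L (toℕ i) (toℕ i′) _ _ i<i′ (row-inBlock i (toℕ<n i)) (row-inBlock i′ (toℕ<n i′))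
          c′-increasing : StrictlyIncreasing c′
          c′-increasing b b′ b<b′ =
            inInterval-ordered L (toℕ b) (toℕ b′) _ _ b<b′ (c′-inBlock b) (c′-inBlock b′)

      zeroRectangle⊎contains : ZeroRectangle ⊎ Contains A P
      zeroRectangle⊎contains = map₂ (λ (r , c , emb) → Complete.contains emb) (embed-rows k ≤-refl)

  module Scale (q′ : ℕ) where

    q q³ : ℕ
    q  = suc q′
    q³ = q * q * q

    module _ (n : ℕ) where

      L d m′ m : ℕ
      L  = n / q
      d  = L / q
      m′ = d / q
      m  = suc m′

      Lq≤n : L * q ≤ n
      Lq≤n = proj₁ (/-bounds n q)
      n<[1+L]q : n < suc L * q
      n<[1+L]q = proj₂ (/-bounds n q)
      dq≤L : d * q ≤ L
      dq≤L = proj₁ (/-bounds L q)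
      L<[1+d]q : L < suc d * q
      L<[1+d]q = proj₂ (/-bounds L q)
      m′q≤d : m′ * q ≤ d
      m′q≤d = proj₁ (/-bounds d q)
      d<mq : d < m * q
      d<mq = proj₂ (/-bounds d q)

      q²≤L : q³ ≤ n → q * q ≤ L
      q²≤L q³≤n = <⇒≤pred (*-cancelʳ-< q (q * q) (suc L) (≤-<-trans q³≤n n<[1+L]q))

      L>0 : q³ ≤ n → 0 < L
      L>0 q³≤n = ≤-trans (s≤s z≤n) (q²≤L q³≤n)

      d≤L : d ≤ L
      d≤L = ≤-trans (m≤m*n d q) dq≤L

      m′q≤L : m′ * q ≤ L
      m′q≤L = ≤-trans m′q≤d d≤L

      n≤m*[1+e] : ∀ e → q³ ≤ e → n ≤ m * suc e
      n≤m*[1+e] e q³≤e = <⇒≤ (begin-strict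
        n              <⟨ n<[1+L]q ⟩
        suc L * q      ≤⟨ *-monoˡ-≤ q L<[1+d]q ⟩
        suc d * q * q  ≤⟨ *-monoˡ-≤ q (*-monoˡ-≤ q d<mq) ⟩
        m * q * q * q  ≡⟨ assoc m q ⟩
        m * q³         ≤⟨ *-monoʳ-≤ m (≤-trans q³≤e (n≤1+n e)) ⟩
        m * suc e      ∎)
        where
        open ≤-Reasoning
        assoc : ∀ m q → m * q * q * q ≡ m * (q * q * q)
        assoc = solve-∀

      few-heavy : ∀ {W H} → W * (q³ * q³) ≤ n * n → suc d * H ≤ W → H * q ≤ L
      few-heavy {W} {H} We≤n² [1+d]H≤W = <⇒≤pred (*-cancelʳ-< q (H * q) (suc L) (begin-strict
        H * q * q  ≤⟨ *-cancelʳ-≤ (H * q * q) n (q * q) Hq⁴≤nq² ⟩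
        n          <⟨ n<[1+L]q ⟩
        suc L * q  ∎))
        where
        open ≤-Reasoning
        regroup : ∀ n d q → n * (d * q * q) ≡ d * (n * (q * q))
        regroup = solve-∀
        regroup′ : ∀ H q → H * q * q * (q * q) * (q * q) ≡ H * (q * q * q * (q * q * q))
        regroup′ = solve-∀
        Hq⁶≤nq² : H * (q³ * q³) ≤ n * (q * q)
        Hq⁶≤nq² = *-cancelˡ-≤ (suc d) (begin
          suc d * (H * (q³ * q³))  ≡⟨ *-assoc (suc d) H (q³ * q³) ⟨
          suc d * H * (q³ * q³)    ≤⟨ *-monoˡ-≤ (q³ * q³) [1+d]H≤W ⟩
          W * (q³ * q³)            ≤⟨ We≤n² ⟩
          n * n                    ≤⟨ *-monoʳ-≤ n (<⇒≤ n<[1+L]q) ⟩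
          n * (suc L * q)          ≤⟨ *-monoʳ-≤ n (*-monoˡ-≤ q L<[1+d]q) ⟩
          n * (suc d * q * q)      ≡⟨ regroup n (suc d) q ⟩
          suc d * (n * (q * q))    ∎)
        Hq⁴≤nq² : H * q * q * (q * q) ≤ n * (q * q)
        Hq⁴≤nq² = begin
          H * q * q * (q * q)            ≤⟨ m≤m*n (H * q * q * (q * q)) (q * q) ⟩
          H * q * q * (q * q) * (q * q)  ≡⟨ regroup′ H q ⟩
          H * (q³ * q³)                  ≤⟨ Hq⁶≤nq² ⟩
          n * (q * q)                    ∎

      j*L≤n : ∀ {j} → j ≤ q → j * L ≤ n
      j*L≤n {j} j≤q = begin
        j * L  ≤⟨ *-monoˡ-≤ L j≤q ⟩
        q * L  ≡⟨ *-comm q L ⟩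
        L * q  ≤⟨ Lq≤n ⟩
        n      ∎
        where open ≤-Reasoning

      j*d<L : ∀ {j} → j < q → q³ ≤ n → j * d < L
      j*d<L {j} j<q q³≤n = *-cancelˡ-< q (j * d) L (begin-strict
        q * (j * d)  ≡⟨ trans (*-comm q (j * d)) (*-assoc j d q) ⟩
        j * (d * q)  ≤⟨ *-monoʳ-≤ j dq≤L ⟩
        j * L        <⟨ *-monoˡ-< L {{>-nonZero (L>0 q³≤n)}} j<q ⟩
        q * L        ∎)
        where open ≤-Reasoning

      row-budget : ∀ {l H} → 2 + 2 * l < q → q³ ≤ n → H * q ≤ L → H + l * d + l * m < L
      row-budget {l} {H} 2+2l<q q³≤n Hq≤L = *-cancelˡ-< q (H + l * d + l * m) L (begin-strict
        q * (H + l * d + l * m)                      ≡⟨ expand q H l d m′ ⟩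
        H * q + l * (d * q) + l * (m′ * q) + q * l   ≤⟨ +-mono-≤ (+-mono-≤ (+-mono-≤ Hq≤L lL) lL′) ql≤L ⟩
        L + l * L + l * L + L                        ≡⟨ collect L l ⟩
        (2 + 2 * l) * L                              <⟨ *-monoˡ-< L {{>-nonZero (L>0 q³≤n)}} 2+2l<q ⟩
        q * L                                        ∎)
        where
        open ≤-Reasoning
        expand : ∀ q H l d m′ → q * (H + l * d + l * suc m′) ≡ H * q + l * (d * q) + l * (m′ * q) + q * l
        expand = solve-∀
        collect : ∀ L l → L + l * L + l * L + L ≡ (2 + 2 * l) * L
        collect = solve-∀
        lL : l * (d * q) ≤ l * L
        lL = *-monoʳ-≤ l dq≤L
        lL′ : l * (m′ * q) ≤ l * L
        lL′ = *-monoʳ-≤ l m′q≤L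
        l≤q : l ≤ q
        l≤q = ≤-trans (≤-trans (m≤m+n l (l + 0)) (≤-trans (n≤1+n _) (n≤1+n _))) (<⇒≤ 2+2l<q)
        ql≤L : q * l ≤ L
        ql≤L = ≤-trans (*-monoʳ-≤ q l≤q) (q²≤L q³≤n)

      col-budget : ∀ {k H} → 3 + k ≤ q → q³ ≤ n → H * q ≤ L → m + H + k * d ≤ L
      col-budget {k} {H} 3+k≤q q³≤n Hq≤L = *-cancelˡ-≤ q (begin
        q * (m + H + k * d)                ≡⟨ expand q m′ H k d ⟩
        m′ * q + q + H * q + k * (d * q)   ≤⟨ +-mono-≤ (+-mono-≤ (+-mono-≤ m′q≤L q≤L) Hq≤L) kL ⟩
        L + L + L + k * L                  ≡⟨ collect L k ⟩
        (3 + k) * L                        ≤⟨ *-monoˡ-≤ L 3+k≤q ⟩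
        q * L                              ∎)
        where
        open ≤-Reasoning
        expand : ∀ q m′ H k d → q * (suc m′ + H + k * d) ≡ m′ * q + q + H * q + k * (d * q)
        expand = solve-∀
        collect : ∀ L k → L + L + L + k * L ≡ (3 + k) * L
        collect = solve-∀
        q≤L : q ≤ L
        q≤L = ≤-trans (m≤m*n q q) (q²≤L q³≤n)
        kL : k * (d * q) ≤ k * L
        kL = *-monoʳ-≤ k dq≤L

  module Density {k l : ℕ} (P : Matrix k l) (P-col : AtMostOneOnePerColumn P) where

    q′ : ℕ
    q′ = 2 + 2 * (k + l)

    open Scale q′

    e : ℕ
    e = q³ * q³

    3+k≤q : 3 + k ≤ q
    3+k≤q = +-monoʳ-≤ 3 (≤-trans (m≤m+n k l) (m≤m+n (k + l) _))

    k<q : k < q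
    k<q = ≤-trans (m≤n+m (suc k) 2) 3+k≤q

    2+2l<q : 2 + 2 * l < q
    2+2l<q = +-monoʳ-≤ 3 (*-monoʳ-≤ 2 (m≤n+m l k))

    l≤q : l ≤ q
    l≤q = ≤-trans (m≤n+m l k) (≤-trans (m≤m+n (k + l) _) (m≤n+m _ 3))

    large-zero-submatrix : ∀ n (A : Matrix n n) → Free A P → e * (n * n) ≤ zeros A * suc e →
      Σ (Subset n) λ R → Σ (Subset n) λ C → n ≤ ∣ R ∣ * suc e × n ≤ ∣ C ∣ * suc e × AllZeroOn A R C
    large-zero-submatrix n A free dense with ones A in #ones
    ... | zero  = ⊤ , ⊤ , n≤n[1+e] , n≤n[1+e] , λ i j _ _ → ones≡0⇒allZero A #ones i j
      where
      n≤n[1+e] : n ≤ ∣ ⊤ {n} ∣ * suc e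
      n≤n[1+e] = subst (λ s → n ≤ s * suc e) (sym (∣⊤∣≡n n)) (m≤m*n n (suc e))
    ... | suc w = [ enlarge , ⊥-elim ∘ free ]′ (E.zeroRectangle⊎contains
      (j*L≤n n (<⇒≤ k<q)) (j*L≤n n l≤q) (row-budget n {l} 2+2l<q q³≤n few-heavy-rows)
      (col-budget n {k} 3+k≤q q³≤n few-heavy-cols) (j*d<L n k<q q³≤n))
      where
      sparse : ones A * e ≤ n * n
      sparse = few-ones {e} {n * n} {zeros A} {ones A} (zeros+ones A) dense
      q³≤n : q³ ≤ n
      q³≤n = ≮⇒≥ λ n<q³ → <⇒≱ (*-mono-< n<q³ n<q³) (begin
        q³ * q³       ≤⟨ m≤m+n e (w * e) ⟩
        suc w * e     ≡⟨ cong (_* e) #ones ⟨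
        ones A * e    ≤⟨ sparse ⟩
        n * n         ∎)
        where open ≤-Reasoning
      module E = Embedding P P-col A (fromℕ< (≤-trans (s≤s z≤n) q³≤n)) (L n) (d n) (m n)
      few-heavy-rows : E.#heavyRows * q ≤ L n
      few-heavy-rows = few-heavy n sparse (count-exceeding n (d n) E.rowOnes)
      few-heavy-cols : E.#heavyCols * q ≤ L n
      few-heavy-cols = few-heavy n sparse
        (≤-trans (count-exceeding n (d n) E.colOnes) (≤-reflexive (sym (sumFin-comm n n λ x y → 𝟙 (A x y)))))
      enlarge : E.ZeroRectangle → Σ (Subset n) λ R → Σ (Subset n) λ C →
                n ≤ ∣ R ∣ * suc e × n ≤ ∣ C ∣ * suc e × AllZeroOn A R C
      enlarge (R , C , m≤∣R∣ , m≤∣C∣ , zero-on) =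
        R , C , ≤-trans n≤m[1+e] (*-monoˡ-≤ (suc e) m≤∣R∣) ,
                ≤-trans n≤m[1+e] (*-monoˡ-≤ (suc e) m≤∣C∣) , zero-on
        where
        n≤m[1+e] : n ≤ m n * suc e
        n≤m[1+e] = n≤m*[1+e] n e (m≤m*n q³ q³)

module ReciprocalBounds where

  open import Data.Integer as ℤ using (+_; -[1+_])
  open import Data.Integer.Properties using (pos-*; *-identityˡ; *-identityʳ; drop‿+≤+)
  open import Data.Nat as ℕ using (ℕ; suc; _+_; _*_; _≤_)
  open import Data.Nat.Coprimality using (1-coprimeTo; sym)
  open import Data.Nat.Properties using (+-identityʳ) renaming (*-identityʳ to *-identityʳ′)
  open import Data.Rational as ℚ using (ℚ; mkℚ; 0ℚ; 1ℚ; toℚᵘ)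
  open import Data.Rational.Properties using (normalize-coprime; toℚᵘ-mono-≤; toℚᵘ-cancel-≤; toℚᵘ-homo-*; toℚᵘ-homo-+)
  open import Data.Rational.Unnormalised as ℚᵘ using (mkℚᵘ; *≤*)
  open import Data.Rational.Unnormalised.Properties using (≃-reflexive; ≃-sym; ≃-trans; *-cong; *-congˡ; ≤-respˡ-≃; ≤-respʳ-≃)
  open import Relation.Binary.PropositionalEquality using (_≡_; refl; cong; subst₂; trans) renaming (sym to ≡-sym)

  1/1+ : ℕ → ℚ
  1/1+ e = mkℚ (+ 1) e (1-coprimeTo (suc e))

  1/1+-pos : ∀ e → 0ℚ ℚ.< 1/1+ e
  1/1+-pos e = ℚ.*<* (ℤ.+<+ (ℕ.s≤s ℕ.z≤n))

  toℚᵘ-toℚ : ∀ n → toℚᵘ (toℚ n) ≡ mkℚᵘ (+ n) 0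
  toℚᵘ-toℚ n = cong toℚᵘ (normalize-coprime (sym (1-coprimeTo n)))

  cross-multiply-hypothesis : ∀ e N Z → (1ℚ ℚ.- 1/1+ e) ℚ.* toℚ N ℚ.≤ toℚ Z → e * N ≤ Z * suc e
  cross-multiply-hypothesis e N Z hyp
    with ≤-respʳ-≃ (≃-reflexive (toℚᵘ-toℚ Z)) (≤-respˡ-≃ as-ℚᵘ (toℚᵘ-mono-≤ hyp))
    where
    as-ℚᵘ : toℚᵘ ((1ℚ ℚ.- 1/1+ e) ℚ.* toℚ N) ℚᵘ.≃
            ((mkℚᵘ (+ 1) 0 ℚᵘ.+ mkℚᵘ -[1+ 0 ] e) ℚᵘ.* mkℚᵘ (+ N) 0)
    as-ℚᵘ = ≃-trans (toℚᵘ-homo-* (1ℚ ℚ.- 1/1+ e) (toℚ N))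
                    (*-cong (toℚᵘ-homo-+ 1ℚ (ℚ.- 1/1+ e)) (≃-reflexive (toℚᵘ-toℚ N)))
  ... | *≤* cross = drop‿+≤+ (subst₂ ℤ._≤_ lhs rhs cross)
    where
    lhs : ((+ 1 ℤ.* + suc e ℤ.+ -[1+ 0 ] ℤ.* + 1) ℤ.* + N) ℤ.* + 1 ≡ + (e * N)
    lhs = trans (*-identityʳ _)
         (trans (cong (λ t → (t ℤ.+ -[1+ 0 ] ℤ.* + 1) ℤ.* + N) (*-identityˡ (+ suc e))) (≡-sym (pos-* e N)))
    rhs : + Z ℤ.* + (suc (e + 0 * suc e) * 1) ≡ + (Z * suc e)
    rhs = trans (≡-sym (pos-* Z _)) (cong (λ t → + (Z * t)) (trans (*-identityʳ′ _) (cong suc (+-identityʳ e))))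

  scaled-conclusion : ∀ e n r → n ≤ r * suc e → 1/1+ e ℚ.* toℚ n ℚ.≤ toℚ r
  scaled-conclusion e n r n≤r[1+e] =
    toℚᵘ-cancel-≤ (≤-respʳ-≃ (≃-sym (≃-reflexive (toℚᵘ-toℚ r))) (≤-respˡ-≃ (≃-sym as-ℚᵘ) cross))
    where
    as-ℚᵘ : toℚᵘ (1/1+ e ℚ.* toℚ n) ℚᵘ.≃ (mkℚᵘ (+ 1) e ℚᵘ.* mkℚᵘ (+ n) 0)
    as-ℚᵘ = ≃-trans (toℚᵘ-homo-* (1/1+ e) (toℚ n)) (*-congˡ {mkℚᵘ (+ 1) e} (≃-reflexive (toℚᵘ-toℚ n)))
    lhs : + n ≡ (+ 1 ℤ.* + n) ℤ.* + 1
    lhs = ≡-sym (trans (*-identityʳ _) (*-identityˡ _))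
    rhs : + (r * suc e) ≡ + r ℤ.* + (suc e * 1)
    rhs = trans (cong (λ t → + (r * t)) (≡-sym (*-identityʳ′ _))) (pos-* r _)
    cross : mkℚᵘ (+ 1) e ℚᵘ.* mkℚᵘ (+ n) 0 ℚᵘ.≤ mkℚᵘ (+ r) 0
    cross = *≤* (subst₂ ℤ._≤_ lhs rhs (ℤ.+≤+ n≤r[1+e]))

open Combinatorics using (module Density)
open ReciprocalBounds using (1/1+; 1/1+-pos; cross-multiply-hypothesis; scaled-conclusion)

open import Data.Nat using (ℕ)
open import Data.Product using (Σ; _×_; _,_)
open import Data.Fin.Subset using (Subset; ∣_∣)
open import Data.Rational using (ℚ; _<_; _≤_; _*_; _-_; 0ℚ; 1ℚ)

lemma7p2 : ∀ {k l} (P : Matrix k l) → AtMostOneOnePerColumn P →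
    Σ ℚ λ ε → 0ℚ < ε ×
      (∀ (n : ℕ) (A : Matrix n n) → Free A P →
        (1ℚ - ε) * toℚ (n Data.Nat.* n) ≤ toℚ (zeros A) →
        Σ (Subset n) λ R → Σ (Subset n) λ C →
          ε * toℚ n ≤ toℚ ∣ R ∣ × ε * toℚ n ≤ toℚ ∣ C ∣ × AllZeroOn A R C)
lemma7p2 P P-col = 1/1+ e , 1/1+-pos e , λ n A free dense →
  let R , C , n≤∣R∣[1+e] , n≤∣C∣[1+e] , zero-on =
        large-zero-submatrix n A free (cross-multiply-hypothesis e (n Data.Nat.* n) (zeros A) dense)
  in R , C , scaled-conclusion e n (∣ R ∣) n≤∣R∣[1+e] , scaled-conclusion e n (∣ C ∣) n≤∣C∣[1+e] , zero-on
  where open Density P P-col using (e; large-zero-submatrix)
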